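{- Let $k\geq 3$ be an integer. For $n\geq 0$ let $r_n^{(k)}$ be the number of binary strings of length $n$ that start with $0$, end with $1$, and contain neither $k$ consecutive $0$'s nor $k$ consecutive $1$'s, with the conventions $r_0^{(k)}=1$ (the empty string counts), $r_1^{(k)}=0$, and $r_{ -i}^{(k)}=0$ for $i\geq 1$. Define $d_n^{(k)}=1$ if $n\equiv 0 \pmod k$, $d_n^{(k)}=-1$ if $n\equiv 1\pmod k$, and $d_n^{(k)}=0$ otherwise. Then for every integer $n\geq 0$, $$r_n^{(k)}=\sum_{j=1}^{k-1} r_{n-j}^{(k)}+d_n^{(k)}.$$ -}

module Defs where

open import Data.Bool using (Bool; true; false)
open import Data.Bool.Properties using () renaming (_≟_ to _≟ᵇ_)
open import Data.Nat using (ℕ; zero; suc; _≤_; _%_; _∸_; NonZero)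
open import Data.Nat.Properties using (_≤?_)
open import Data.List using (List; []; _∷_; concatMap; length; filter; replicate; head; last)
open import Data.List.Relation.Binary.Infix.Heterogeneous using (Infix)
open import Data.List.Relation.Binary.Infix.Heterogeneous.Properties using (infix?)
open import Data.Maybe using (Maybe; just; nothing)
open import Data.Maybe.Properties using (≡-dec)
open import Data.Integer using (ℤ; +_; -_; _+_; 0ℤ; 1ℤ)
open import Data.Product using (_×_)
open import Relation.Nullary using (¬_; Dec; yes; no)
open import Relation.Nullary.Decidable using (_×-dec_; ¬?)
open import Relation.Binary.PropositionalEquality using (_≡_)

-- Binary strings are lists of Bool, with false = 0 and true = 1.

allStrings : ℕ → List (List Bool)
allStrings zero    = [] ∷ []
allStrings (suc n) = concatMap (λ s → (false ∷ s) ∷ (true ∷ s) ∷ []) (allStrings n)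

HasRun : ℕ → Bool → List Bool → Set
HasRun k b s = Infix _≡_ (replicate k b) s

Good : ℕ → List Bool → Set
Good k s = (head s ≡ just false) × (last s ≡ just true)
         × (¬ HasRun k false s) × (¬ HasRun k true s)

good? : (k : ℕ) (s : List Bool) → Dec (Good k s)
good? k s = ≡-dec _≟ᵇ_ (head s) (just false)
      ×-dec ≡-dec _≟ᵇ_ (last s) (just true)
      ×-dec ¬? (infix? _≟ᵇ_ (replicate k false) s)
      ×-dec ¬? (infix? _≟ᵇ_ (replicate k true) s)

-- r_n^(k) for n ≥ 0, with the convention r_0^(k) = 1.
-- (For n = 1 the count is 0 automatically; for n ≥ 2 it is the literal count.)
r : ℕ → ℕ → ℤ
r k zero    = 1ℤ
r k (suc n) = + length (filter (good? k) (allStrings (suc n)))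

rShift : ℕ → ℕ → ℕ → ℤ
rShift k n j with j ≤? n
... | yes _ = r k (n ∸ j)
... | no  _ = 0ℤ

sumFrom1 : ℕ → (ℕ → ℤ) → ℤ
sumFrom1 zero    f = 0ℤ
sumFrom1 (suc m) f = sumFrom1 m f + f (suc m)

d : (k : ℕ) → .{{NonZero k}} → ℕ → ℤ
d k n with n % k
... | zero        = 1ℤ
... | suc zero    = - 1ℤ
... | suc (suc _) = 0ℤ

module Submission where

-- Call a binary string k-admissible when it ends with 1 and has no run of k equal
-- symbols, and let T n (resp. U n) count the k-admissible strings of length n that
-- begin with 0 (resp. 1), the empty string being counted in T 0.  Then r k = T.
-- Reading off the initial run of an admissible string (length j, 1 ≤ j ≤ k-1) gives
--   T n′ = Σ_{j=1}^{k-1} U (n′-j)  (n′ ≥ 1)   and   U n = Σ_{j=1}^{k-1} T (n-j),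
-- so the difference T - U satisfies the "alternating" recurrence
--   f (n+1) + Σ_{j=1}^{k-1} f (n+1-j) = 0,
-- which determines a sequence from its value at 0.  The k-periodic sign sequence d
-- solves it as well and d 0 = 1 = T 0 - U 0, hence T - U = d and
--   r k n = T n = U n + (T n - U n) = Σ_{j=1}^{k-1} r k (n-j) + d k n.

open import Defs
open import Level using (Level)
open import Data.Bool using (Bool; true; false; not)
open import Data.Bool.Properties using () renaming (_≟_ to _≟ᵇ_)
open import Data.Nat as ℕ
  using (ℕ; zero; suc; _≤_; _<_; _∸_; z≤n; s≤s; _%_; NonZero)
open import Data.Nat.Properties as ℕP
  using (_≤?_; +-suc; +-comm; ≤-trans; m∸n+n≡m; ≰⇒>; m≤n⇒m≤1+n)
open import Data.Nat.DivMod using ([m+n]%n≡m%n; m<n⇒m%n≡m)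
open import Data.Nat.Induction using (<-rec)
open import Data.Integer using (ℤ; +_; -_; _+_; _-_; 0ℤ; 1ℤ)
open import Data.Integer.Properties as ℤP using (pos-+; +-0-abelianGroup)
open import Algebra.Properties.AbelianGroup +-0-abelianGroup using (inverseˡ-unique)
open import Data.Integer.Tactic.RingSolver using (solve-∀)
open import Data.List using (List; []; _∷_; length; filter; replicate; last; _++_; concatMap)
open import Data.List.Properties using (filter-≐; filter-none; filter-accept; filter-reject; ++-identityʳ; length-replicate)
open import Data.List.Relation.Unary.All using (universal)
open import Data.List.Relation.Binary.Infix.Heterogeneous using (here; there; _++ⁱ_)
open import Data.List.Relation.Binary.Infix.Heterogeneous.Properties using (infix?; length-mono)
open import Data.List.Relation.Binary.Prefix.Heterogeneous using (Prefix; []; _∷_)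
open import Data.Maybe using (just)
open import Data.Maybe.Properties using (≡-dec)
open import Data.Product using (_×_; _,_)
open import Data.Empty using (⊥-elim)
open import Relation.Nullary using (¬_; yes; no)
open import Relation.Nullary.Decidable using (_×-dec_; ¬?)
open import Relation.Unary using (Pred; Decidable; _≐_)
open import Relation.Binary.PropositionalEquality
  using (_≡_; _≢_; refl; sym; trans; cong; cong₂; subst; subst₂; module ≡-Reasoning)

open ≡-Reasoning

module _ {a p : Level} {A : Set a} {P : Pred A p} (P? : Decidable P) where

  count : List A → ℕ
  count xs = length (filter P? xs)

  count-none : (∀ x → ¬ P x) → ∀ xs → count xs ≡ 0
  count-none ¬P xs = cong length (filter-none P? (universal ¬P xs))

  count-accept : ∀ {x} → P x → count (x ∷ []) ≡ 1
  count-accept Px = cong length (filter-accept P? Px)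

  count-reject : ∀ {x} → ¬ P x → count (x ∷ []) ≡ 0
  count-reject ¬Px = cong length (filter-reject P? ¬Px)

count-≐ : ∀ {a p q} {A : Set a} {P : Pred A p} {Q : Pred A q}
          (P? : Decidable P) (Q? : Decidable Q) → P ≐ Q → ∀ xs → count P? xs ≡ count Q? xs
count-≐ P? Q? P≐Q xs = cong length (filter-≐ P? Q? P≐Q xs)

count-allStrings-suc : ∀ {p} {P : Pred (List Bool) p} (P? : Decidable P) m →
  count P? (allStrings (suc m))
    ≡ count (λ t → P? (false ∷ t)) (allStrings m) ℕ.+ count (λ t → P? (true ∷ t)) (allStrings m)
count-allStrings-suc P? m = split (allStrings m)
  where
  split : ∀ xs → count P? (concatMap (λ s → (false ∷ s) ∷ (true ∷ s) ∷ []) xs)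
                   ≡ count (λ t → P? (false ∷ t)) xs ℕ.+ count (λ t → P? (true ∷ t)) xs
  split [] = refl
  split (x ∷ xs) with P? (false ∷ x)
  ... | yes _ with P? (true ∷ x)
  ...   | yes _ = cong suc (trans (cong suc (split xs)) (sym (+-suc _ _)))
  ...   | no  _ = cong suc (split xs)
  split (x ∷ xs) | no _ with P? (true ∷ x)
  ...   | yes _ = trans (cong suc (split xs)) (sym (+-suc _ _))
  ...   | no  _ = split xs

replicate-snoc : ∀ ℓ (b : Bool) t → replicate ℓ b ++ b ∷ t ≡ replicate (suc ℓ) b ++ t
replicate-snoc zero    b t = refl
replicate-snoc (suc ℓ) b t = cong (b ∷_) (replicate-snoc ℓ b t)

replicate-prefix : ∀ k (b : Bool) t → Prefix _≡_ (replicate k b) (replicate k b ++ t)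
replicate-prefix zero    b t = []
replicate-prefix (suc k) b t = refl ∷ replicate-prefix k b t

last-replicate : ∀ ℓ (b : Bool) → last (replicate (suc ℓ) b) ≡ just b
last-replicate zero    b = refl
last-replicate (suc ℓ) b = last-replicate ℓ b

last-after-replicate : ∀ ℓ (b c : Bool) t → last (replicate ℓ b ++ c ∷ t) ≡ last (c ∷ t)
last-after-replicate zero          b c t = refl
last-after-replicate (suc zero)    b c t = refl
last-after-replicate (suc (suc ℓ)) b c t = last-after-replicate (suc ℓ) b c t

short-block-no-prefix : ∀ {k ℓ} {b c : Bool} {t} → ℓ < k → c ≢ b →
  ¬ Prefix _≡_ (replicate k b) (replicate ℓ b ++ c ∷ t)
short-block-no-prefix {ℓ = zero}  (s≤s _) c≢b (b≡c ∷ _) = c≢b (sym b≡c)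
short-block-no-prefix {ℓ = suc ℓ} (s≤s l) c≢b (_ ∷ p)   = short-block-no-prefix l c≢b p

-- A run of length k in b^ℓ c t (ℓ < k, c ≠ b) cannot meet the leading block,
-- so it already occurs in c t.
run-after-short-block : ∀ {k ℓ} {x b c : Bool} {t} → ℓ < k → c ≢ b →
  HasRun k x (replicate ℓ b ++ c ∷ t) → HasRun k x (c ∷ t)
run-after-short-block {ℓ = zero} _ _ run = run
run-after-short-block {suc k} {suc ℓ} (s≤s l) c≢b (here (refl ∷ p)) =
  ⊥-elim (short-block-no-prefix l c≢b p)
run-after-short-block {ℓ = suc ℓ} l c≢b (there run) =
  run-after-short-block (≤-trans (ℕP.n≤1+n (suc ℓ)) l) c≢b run

shifted : (ℕ → ℤ) → ℕ → ℕ → ℤ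
shifted f n       zero    = f n
shifted f zero    (suc j) = 0ℤ
shifted f (suc n) (suc j) = shifted f n j

shifted-≤ : ∀ f {n j} → j ≤ n → shifted f n j ≡ f (n ∸ j)
shifted-≤ f {j = zero}  _         = refl
shifted-≤ f {j = suc j} (s≤s j≤n) = shifted-≤ f j≤n

shifted-> : ∀ f {n j} → n < j → shifted f n j ≡ 0ℤ
shifted-> f {zero}  {suc j} _         = refl
shifted-> f {suc n} {suc j} (s≤s n<j) = shifted-> f n<j

shifted-cong : ∀ {f g} n → (∀ i → i < n → f i ≡ g i) → ∀ j → shifted f n (suc j) ≡ shifted g n (suc j)
shifted-cong zero    _  j       = refl
shifted-cong (suc n) eq zero    = eq n ℕP.≤-refl
shifted-cong (suc n) eq (suc j) = shifted-cong n (λ i i<n → eq i (m≤n⇒m≤1+n i<n)) j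

shifted-sub : ∀ f g n j → shifted (λ i → f i - g i) n j ≡ shifted f n j - shifted g n j
shifted-sub f g n       zero    = refl
shifted-sub f g zero    (suc j) = refl
shifted-sub f g (suc n) (suc j) = shifted-sub f g n j

sumFrom1-cong : ∀ m {g h : ℕ → ℤ} → (∀ j → g (suc j) ≡ h (suc j)) → sumFrom1 m g ≡ sumFrom1 m h
sumFrom1-cong zero    eq = refl
sumFrom1-cong (suc m) eq = cong₂ _+_ (sumFrom1-cong m eq) (eq m)

sumFrom1-zero : ∀ m {g : ℕ → ℤ} → (∀ j → g (suc j) ≡ 0ℤ) → sumFrom1 m g ≡ 0ℤ
sumFrom1-zero zero    eq = refl
sumFrom1-zero (suc m) eq = cong₂ _+_ (sumFrom1-zero m eq) (eq m)

sumFrom1-first : ∀ m (g : ℕ → ℤ) → sumFrom1 (suc m) g ≡ g 1 + sumFrom1 m (λ j → g (suc j))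
sumFrom1-first zero    g = ℤP.+-comm 0ℤ (g 1)
sumFrom1-first (suc m) g = begin
  sumFrom1 (suc m) g + g (suc (suc m))
    ≡⟨ cong (_+ g (suc (suc m))) (sumFrom1-first m g) ⟩
  (g 1 + sumFrom1 m (λ j → g (suc j))) + g (suc (suc m))
    ≡⟨ ℤP.+-assoc (g 1) _ _ ⟩
  g 1 + sumFrom1 (suc m) (λ j → g (suc j)) ∎

sumFrom1-sub : ∀ m (g h : ℕ → ℤ) → sumFrom1 m (λ j → g j - h j) ≡ sumFrom1 m g - sumFrom1 m h
sumFrom1-sub zero    g h = refl
sumFrom1-sub (suc m) g h = begin
  sumFrom1 m (λ j → g j - h j) + (g (suc m) - h (suc m))
    ≡⟨ cong (_+ (g (suc m) - h (suc m))) (sumFrom1-sub m g h) ⟩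
  (sumFrom1 m g - sumFrom1 m h) + (g (suc m) - h (suc m))
    ≡⟨ interchange (sumFrom1 m g) (sumFrom1 m h) (g (suc m)) (h (suc m)) ⟩
  (sumFrom1 m g + g (suc m)) - (sumFrom1 m h + h (suc m)) ∎
  where
  interchange : ∀ a b c e → (a - b) + (c - e) ≡ (a + c) - (b + e)
  interchange = solve-∀

window : ℕ → (ℕ → ℤ) → ℕ → ℤ
window m f n = sumFrom1 m (shifted f n)

window-zero : ∀ m f → window m f 0 ≡ 0ℤ
window-zero m f = sumFrom1-zero m (λ _ → refl)

window-suc : ∀ m f n → window (suc m) f (suc n) ≡ f n + window m f n
window-suc m f n = sumFrom1-first m (shifted f (suc n))

window-sub : ∀ m f g n → window m (λ i → f i - g i) n ≡ window m f n - window m g n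
window-sub m f g n =
  trans (sumFrom1-cong m (λ j → shifted-sub f g n (suc j))) (sumFrom1-sub m (shifted f n) (shifted g n))

window-cong : ∀ m {f g} n → (∀ i → i < n → f i ≡ g i) → window m f n ≡ window m g n
window-cong m n eq = sumFrom1-cong m (shifted-cong n eq)

rShift-window : ∀ k m n → sumFrom1 m (rShift k n) ≡ window m (r k) n
rShift-window k m n = sumFrom1-cong m lag
  where
  lag : ∀ j → rShift k n (suc j) ≡ shifted (r k) n (suc j)
  lag j with suc j ≤? n
  ... | yes j<n = sym (shifted-≤ (r k) j<n)
  ... | no  j≮n = sym (shifted-> (r k) (≰⇒> j≮n))

Alternating : ℕ → (ℕ → ℤ) → Set
Alternating m f = ∀ n → f (suc n) + window m f (suc n) ≡ 0ℤ

alternating-unique : ∀ {m f g} → Alternating m f → Alternating m g → f 0 ≡ g 0 → ∀ n → f n ≡ g n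
alternating-unique {m} {f} {g} alt-f alt-g f0≡g0 = <-rec (λ n → f n ≡ g n) agree
  where
  agree : ∀ n → (∀ {i} → i < n → f i ≡ g i) → f n ≡ g n
  agree zero    _  = f0≡g0
  agree (suc n) ih = begin
    f (suc n)                 ≡⟨ inverseˡ-unique _ _ (alt-f n) ⟩
    - window m f (suc n)      ≡⟨ cong -_ (window-cong m (suc n) (λ i i<n → ih i<n)) ⟩
    - window m g (suc n)      ≡⟨ sym (inverseˡ-unique _ _ (alt-g n)) ⟩
    g (suc n)                 ∎

residueSign : ℕ → ℤ
residueSign zero          = 1ℤ
residueSign (suc zero)    = - 1ℤ
residueSign (suc (suc _)) = 0ℤ

d-residue : ∀ k .{{_ : NonZero k}} n → d k n ≡ residueSign (n % k)
d-residue k n with n % k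
... | zero        = refl
... | suc zero    = refl
... | suc (suc _) = refl

d-periodic : ∀ k .{{_ : NonZero k}} n → d k (n ℕ.+ k) ≡ d k n
d-periodic k n = begin
  d k (n ℕ.+ k)               ≡⟨ d-residue k (n ℕ.+ k) ⟩
  residueSign ((n ℕ.+ k) % k) ≡⟨ cong residueSign ([m+n]%n≡m%n n k) ⟩
  residueSign (n % k)         ≡⟨ sym (d-residue k n) ⟩
  d k n                       ∎

d-vanishes : ∀ k .{{_ : NonZero k}} n → suc (suc n) < k → d k (suc (suc n)) ≡ 0ℤ
d-vanishes k n small = trans (d-residue k (suc (suc n))) (cong residueSign (m<n⇒m%n≡m small))

module _ (m : ℕ) where

  private
    k : ℕ
    k = suc (suc m)

  -- d (n+2) equals the value k-1 places earlier: by periodicity if that place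
  -- exists, and both vanish otherwise.
  d-lagged : ∀ n → d k (suc (suc n)) ≡ shifted (d k) (suc n) (suc m)
  d-lagged n with suc m ≤? suc n
  ... | yes early = begin
    d k (suc (suc n))                   ≡⟨ cong (d k) (sym back) ⟩
    d k ((suc n ∸ suc m) ℕ.+ k)         ≡⟨ d-periodic k (suc n ∸ suc m) ⟩
    d k (suc n ∸ suc m)                 ≡⟨ sym (shifted-≤ (d k) early) ⟩
    shifted (d k) (suc n) (suc m)       ∎
    where
    back : (suc n ∸ suc m) ℕ.+ k ≡ suc (suc n)
    back = trans (+-suc (suc n ∸ suc m) (suc m)) (cong suc (m∸n+n≡m early))
  ... | no late = trans (d-vanishes k n (s≤s (≰⇒> late))) (sym (shifted-> (d k) (≰⇒> late)))

  d-alternating : Alternating (suc m) (d k)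
  d-alternating zero =
    cong (λ x → d k 1 + x) (trans (window-suc m (d k) 0) (cong (λ x → d k 0 + x) (window-zero m (d k))))
  d-alternating (suc n) = begin
    d k (suc (suc n)) + window (suc m) (d k) (suc (suc n))
      ≡⟨ cong (λ x → d k (suc (suc n)) + x) (window-suc m (d k) (suc n)) ⟩
    d k (suc (suc n)) + (d k (suc n) + window m (d k) (suc n))
      ≡⟨ rotate (d k (suc (suc n))) (d k (suc n)) (window m (d k) (suc n)) ⟩
    d k (suc n) + (window m (d k) (suc n) + d k (suc (suc n)))
      ≡⟨ cong (λ x → d k (suc n) + (window m (d k) (suc n) + x)) (d-lagged n) ⟩
    d k (suc n) + window (suc m) (d k) (suc n)
      ≡⟨ d-alternating n ⟩
    0ℤ ∎
    where
    rotate : ∀ a b c → a + (b + c) ≡ b + (c + a)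
    rotate = solve-∀

module Runs (k : ℕ) where

  -- Ends with 1 and contains no k consecutive 0's or 1's; Good k s is exactly
  -- "begins with 0" together with admissibility.
  Admissible : List Bool → Set
  Admissible s = (last s ≡ just true) × (¬ HasRun k false s) × (¬ HasRun k true s)

  admissible? : Decidable Admissible
  admissible? s = ≡-dec _≟ᵇ_ (last s) (just true)
           ×-dec ¬? (infix? _≟ᵇ_ (replicate k false) s)
           ×-dec ¬? (infix? _≟ᵇ_ (replicate k true) s)

  admissible-drop-block : ∀ {ℓ} {b c : Bool} → ℓ < k → c ≢ b →
    (λ t → Admissible (replicate ℓ b ++ c ∷ t)) ≐ (λ t → Admissible (c ∷ t))
  admissible-drop-block {ℓ} {b} {c} l c≢b =
    (λ {t} (end , no0 , no1) →
      trans (sym (last-after-replicate ℓ b c t)) end ,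
      (λ run → no0 (replicate ℓ b ++ⁱ run)) , (λ run → no1 (replicate ℓ b ++ⁱ run))) ,
    (λ {t} (end , no0 , no1) →
      trans (last-after-replicate ℓ b c t) end ,
      (λ run → no0 (run-after-short-block l c≢b run)) ,
      (λ run → no1 (run-after-short-block l c≢b run)))

  inadmissible-full-block : ∀ (b : Bool) t → ¬ Admissible (replicate k b ++ t)
  inadmissible-full-block false t (_ , no0 , _) = no0 (here (replicate-prefix k false t))
  inadmissible-full-block true  t (_ , _ , no1) = no1 (here (replicate-prefix k true t))

  admissible-ones : ∀ ℓ → suc ℓ < k → Admissible (replicate (suc ℓ) true)
  admissible-ones ℓ l = last-replicate ℓ true , no-run , no-run
    where
    no-run : ∀ {x} → ¬ HasRun k x (replicate (suc ℓ) true)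
    no-run run = ℕP.<⇒≱ l (subst₂ _≤_ (length-replicate k) (length-replicate (suc ℓ)) (length-mono run))

  extensions : Bool → ℕ → ℕ → ℕ
  extensions b ℓ m = count (λ t → admissible? (replicate ℓ b ++ t)) (allStrings m)

  -- startCount c n: admissible strings of length n beginning with c, where the
  -- empty string counts as beginning with 0 (the convention r_0 = 1).
  emptyStart : Bool → ℤ
  emptyStart false = 1ℤ
  emptyStart true  = 0ℤ

  startCount : Bool → ℕ → ℤ
  startCount c zero    = emptyStart c
  startCount c (suc n) = + extensions c 1 n

  extend-block : ∀ b ℓ m →
    count (λ t → admissible? (replicate ℓ b ++ b ∷ t)) (allStrings m) ≡ extensions b (suc ℓ) m
  extend-block b ℓ m = count-≐ _ _
    ((λ {t} → subst Admissible (replicate-snoc ℓ b t)) ,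
     (λ {t} → subst Admissible (sym (replicate-snoc ℓ b t))))
    (allStrings m)

  end-block : ∀ {b c} ℓ m → ℓ < k → c ≢ b →
    count (λ t → admissible? (replicate ℓ b ++ c ∷ t)) (allStrings m) ≡ extensions c 1 m
  end-block ℓ m l c≢b = count-≐ _ _ (admissible-drop-block l c≢b) (allStrings m)

  extensions-step : ∀ b ℓ m → ℓ < k →
    extensions b ℓ (suc m) ≡ extensions (not b) 1 m ℕ.+ extensions b (suc ℓ) m
  extensions-step false ℓ m l = begin
    extensions false ℓ (suc m)
      ≡⟨ count-allStrings-suc (λ t → admissible? (replicate ℓ false ++ t)) m ⟩
    count (λ t → admissible? (replicate ℓ false ++ false ∷ t)) (allStrings m)
      ℕ.+ count (λ t → admissible? (replicate ℓ false ++ true ∷ t)) (allStrings m)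
      ≡⟨ cong₂ ℕ._+_ (extend-block false ℓ m) (end-block ℓ m l λ ()) ⟩
    extensions false (suc ℓ) m ℕ.+ extensions true 1 m
      ≡⟨ +-comm (extensions false (suc ℓ) m) (extensions true 1 m) ⟩
    extensions true 1 m ℕ.+ extensions false (suc ℓ) m ∎
  extensions-step true ℓ m l = begin
    extensions true ℓ (suc m)
      ≡⟨ count-allStrings-suc (λ t → admissible? (replicate ℓ true ++ t)) m ⟩
    count (λ t → admissible? (replicate ℓ true ++ false ∷ t)) (allStrings m)
      ℕ.+ count (λ t → admissible? (replicate ℓ true ++ true ∷ t)) (allStrings m)
      ≡⟨ cong₂ ℕ._+_ (end-block ℓ m l λ ()) (extend-block true ℓ m) ⟩
    extensions false 1 m ℕ.+ extensions true (suc ℓ) m ∎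

  extensions-full : ∀ b m → extensions b k m ≡ 0
  extensions-full b m =
    count-none (λ t → admissible? (replicate k b ++ t)) (inadmissible-full-block b) (allStrings m)

  -- A short block b^ℓ (1 ≤ ℓ < k) is itself admissible exactly when b = 1, which is
  -- also what startCount (not b) 0 records.
  extensions-base : ∀ b ℓ → suc ℓ < k → + extensions b (suc ℓ) 0 ≡ startCount (not b) 0
  extensions-base false ℓ l =
    cong +_ (count-reject (λ t → admissible? (replicate (suc ℓ) false ++ t))
                          (λ adm → ends-with-zero (subst Admissible (++-identityʳ _) adm)))
    where
    ends-with-zero : ¬ Admissible (replicate (suc ℓ) false)
    ends-with-zero (end , _) with trans (sym (last-replicate ℓ false)) end
    ... | ()
  extensions-base true ℓ l =
    cong +_ (count-accept (λ t → admissible? (replicate (suc ℓ) true ++ t))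
                          (subst Admissible (sym (++-identityʳ _)) (admissible-ones ℓ l)))

  -- Cutting off the initial block: if k = rest + (ℓ+1), an admissible string beginning
  -- with b^(ℓ+1) continues with j-1 further b's (1 ≤ j ≤ rest) and then with not b.
  extensions-window : ∀ b rest ℓ n → k ≡ rest ℕ.+ suc ℓ →
    + extensions b (suc ℓ) n ≡ window rest (startCount (not b)) (suc n)
  extensions-window b zero ℓ n k≡ =
    cong +_ (subst (λ x → extensions b x n ≡ 0) k≡ (extensions-full b n))
  extensions-window b (suc rest) ℓ n k≡ = go n
    where
    next : ℕ → ℤ
    next = startCount (not b)
    ℓ<k : suc ℓ < k
    ℓ<k = subst (suc ℓ <_) (sym k≡) (ℕP.m<n+m (suc ℓ) (s≤s z≤n))
    k≡′ : k ≡ rest ℕ.+ suc (suc ℓ)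
    k≡′ = trans k≡ (sym (+-suc rest (suc ℓ)))
    go : ∀ n → + extensions b (suc ℓ) n ≡ window (suc rest) next (suc n)
    go zero = begin
      + extensions b (suc ℓ) 0          ≡⟨ extensions-base b ℓ ℓ<k ⟩
      next 0                            ≡⟨ sym (ℤP.+-identityʳ (next 0)) ⟩
      next 0 + 0ℤ                       ≡⟨ cong (λ x → next 0 + x) (sym (window-zero rest next)) ⟩
      next 0 + window rest next 0       ≡⟨ sym (window-suc rest next 0) ⟩
      window (suc rest) next 1          ∎
    go (suc n) = begin
      + extensions b (suc ℓ) (suc n)
        ≡⟨ cong +_ (extensions-step b (suc ℓ) n ℓ<k) ⟩
      + (extensions (not b) 1 n ℕ.+ extensions b (suc (suc ℓ)) n)
        ≡⟨ pos-+ (extensions (not b) 1 n) _ ⟩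
      next (suc n) + + extensions b (suc (suc ℓ)) n
        ≡⟨ cong (λ x → next (suc n) + x) (extensions-window b rest (suc ℓ) n k≡′) ⟩
      next (suc n) + window rest next (suc n)
        ≡⟨ sym (window-suc rest next (suc n)) ⟩
      window (suc rest) next (suc (suc n)) ∎

  -- The first run has length j ∈ [1, k-1] and is followed by a string beginning with
  -- the other symbol.
  startCount-recurrence : 1 < k → ∀ c n →
    startCount c (suc n) ≡ window (k ∸ 1) (startCount (not c)) (suc n)
  startCount-recurrence 1<k c n =
    extensions-window c (k ∸ 1) 0 n (sym (m∸n+n≡m (≤-trans (ℕP.n≤1+n 1) 1<k)))

  r-startCount : ∀ n → r k n ≡ startCount false n
  r-startCount zero    = refl
  r-startCount (suc n) = cong +_ (begin
    count (good? k) (allStrings (suc n))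
      ≡⟨ count-allStrings-suc (good? k) n ⟩
    count (λ t → good? k (false ∷ t)) (allStrings n) ℕ.+ count (λ t → good? k (true ∷ t)) (allStrings n)
      ≡⟨ cong₂ ℕ._+_ (count-≐ _ _ ((λ (_ , adm) → adm) , (λ adm → refl , adm)) (allStrings n))
                     (count-none (λ t → good? k (true ∷ t)) (λ _ ()) (allStrings n)) ⟩
    extensions false 1 n ℕ.+ 0
      ≡⟨ ℕP.+-identityʳ _ ⟩
    extensions false 1 n ∎)

module Recurrence (m : ℕ) where

  k : ℕ
  k = suc (suc m)

  open Runs k

  T U : ℕ → ℤ
  T = startCount false
  U = startCount true

  1<k : 1 < k
  1<k = s≤s (s≤s z≤n)

  T-recurrence : ∀ n → T (suc n) ≡ window (suc m) U (suc n)
  T-recurrence = startCount-recurrence 1<k false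

  U-recurrence : ∀ n → U n ≡ window (suc m) T n
  U-recurrence zero    = sym (window-zero (suc m) T)
  U-recurrence (suc n) = startCount-recurrence 1<k true n

  difference-alternating : Alternating (suc m) (λ n → T n - U n)
  difference-alternating n = begin
    (T (suc n) - U (suc n)) + window (suc m) (λ i → T i - U i) (suc n)
      ≡⟨ cong₂ _+_ (cong₂ _-_ (T-recurrence n) (U-recurrence (suc n)))
                   (window-sub (suc m) T U (suc n)) ⟩
    (window (suc m) U (suc n) - window (suc m) T (suc n))
      + (window (suc m) T (suc n) - window (suc m) U (suc n))
      ≡⟨ cancel (window (suc m) U (suc n)) (window (suc m) T (suc n)) ⟩
    0ℤ ∎
    where
    cancel : ∀ a b → (a - b) + (b - a) ≡ 0ℤ
    cancel = solve-∀

  difference≡d : ∀ n → T n - U n ≡ d k n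
  difference≡d = alternating-unique {suc m} difference-alternating (d-alternating m) refl

  r-recurrence : ∀ n → r k n ≡ sumFrom1 (suc m) (rShift k n) + d k n
  r-recurrence n = begin
    r k n                               ≡⟨ r-startCount n ⟩
    T n                                 ≡⟨ split (T n) (U n) ⟩
    U n + (T n - U n)                   ≡⟨ cong₂ _+_ (U-recurrence n) (difference≡d n) ⟩
    window (suc m) T n + d k n          ≡⟨ cong (_+ d k n) (window-cong (suc m) n (λ i _ → sym (r-startCount i))) ⟩
    window (suc m) (r k) n + d k n      ≡⟨ cong (_+ d k n) (sym (rShift-window k (suc m) n)) ⟩
    sumFrom1 (suc m) (rShift k n) + d k n ∎
    where
    split : ∀ a b → a ≡ b + (a - b)
    split = solve-∀

proposition3p1 : (k : ℕ) → 3 ≤ k → .{{_ : NonZero k}} → (n : ℕ) →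
    r k n ≡ sumFrom1 (k ∸ 1) (rShift k n) + d k n
proposition3p1 (suc (suc (suc k₀))) (s≤s (s≤s (s≤s z≤n))) = Recurrence.r-recurrence (suc k₀)
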